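{- Let $G$ be a bipartite graph. If $G$ is constructible by conditioning, then $G$ has a construction (a finite sequence of doubling and collapse operations starting from a single edge and ending with $G$, up to renaming of vertices) in which all operations except the last one are doublings.
   Context: A bipartite graph $(X,Y,E)$ with $E\subseteq X\times Y$ is viewed as a 2-partite hypergraph. A homomorphism $(X,Y,E)\to(X',Y',E')$ is a pair of maps $X\to X'$, $Y\to Y'$ mapping edges to edges. For $X_0\subseteq X,Y_0\subseteq Y$ the induced subgraph is $(X_0,Y_0,E\cap(X_0\times Y_0))$. Operations: Doubling: given a graph whose vertices are partitioned into "fixed" and "old" vertices, add for every old vertex $q$ a fresh copy $q'$ on the same side, and for every edge $e$ not both of whose endpoints are fixed add the edge $e'$ obtained by replacing each old endpoint by its copy (keeping all previous edges). Collapse: given $H$ and an induced subgraph $H_0$ of $H$ such that some homomorphism $H\to H_0$ is the identity on the vertices of $H_0$, replace $H$ by $H_0$. A graph is constructible by conditioning if it is obtained from a single edge by a finite sequence of these operations (up to renaming of vertices). -}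

module Defs where

open import Data.Bool using (Bool; true; false; T; not; _∧_)
open import Data.Unit using (⊤; tt)
open import Data.Sum using (_⊎_; inj₁; inj₂)
open import Data.Product using (Σ; _×_; _,_; proj₁)
open import Function.Bundles using (_↔_; Inverse)
open import Relation.Binary.PropositionalEquality using (_≡_)

-- Vertex sets are arbitrary types;
-- all graphs reachable from a single edge are automatically finite.
record BGraph : Set₁ where
  field
    X : Set
    Y : Set
    E : X → Y → Bool
open BGraph public

record Iso (G H : BGraph) : Set where
  field
    isoX : X G ↔ X H
    isoY : Y G ↔ Y H
    edges : ∀ x y → E G x y ≡ E H (Inverse.to isoX x) (Inverse.to isoY y)

SingleEdge : BGraph
SingleEdge = record { X = ⊤ ; Y = ⊤ ; E = λ _ _ → true }

record Hom (G H : BGraph) : Set where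
  field
    homX : X G → X H
    homY : Y G → Y H
    preserves : ∀ x y → T (E G x y) → T (E H (homX x) (homY y))

-- Doubling.  fx / fy mark the FIXED vertices (true = fixed, false = old).
-- New vertices: inj₁ v = original vertex, inj₂ (q , _) = copy q' of old q.
-- Edges: all old edges, plus for every edge e = (x , y) not both of whose
-- endpoints are fixed the edge e' obtained by replacing old endpoints by copies.
Double : (G : BGraph) → (X G → Bool) → (Y G → Bool) → BGraph
Double G fx fy = record
  { X = X G ⊎ Σ (X G) (λ x → T (not (fx x)))
  ; Y = Y G ⊎ Σ (Y G) (λ y → T (not (fy y)))
  ; E = e
  }
  where
  e : X G ⊎ Σ (X G) (λ x → T (not (fx x))) → Y G ⊎ Σ (Y G) (λ y → T (not (fy y))) → Bool
  e (inj₁ x)       (inj₁ y)       = E G x y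
  e (inj₁ x)       (inj₂ (y , _)) = E G x y ∧ fx x
  e (inj₂ (x , _)) (inj₁ y)       = E G x y ∧ fy y
  e (inj₂ (x , _)) (inj₂ (y , _)) = E G x y

Induced : (G : BGraph) → (X G → Bool) → (Y G → Bool) → BGraph
Induced G PX PY = record
  { X = Σ (X G) (λ x → T (PX x))
  ; Y = Σ (Y G) (λ y → T (PY y))
  ; E = λ x y → E G (proj₁ x) (proj₁ y)
  }

DoublingStep : BGraph → BGraph → Set
DoublingStep G H = Σ (X G → Bool) λ fx → Σ (Y G → Bool) λ fy → Iso (Double G fx fy) H

record Retraction (G : BGraph) (PX : X G → Bool) (PY : Y G → Bool) : Set where
  field
    hom : Hom G (Induced G PX PY)
    idX : ∀ x → T (PX x) → proj₁ (Hom.homX hom x) ≡ x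
    idY : ∀ y → T (PY y) → proj₁ (Hom.homY hom y) ≡ y

CollapseStep : BGraph → BGraph → Set
CollapseStep G H = Σ (X G → Bool) λ PX → Σ (Y G → Bool) λ PY →
  Retraction G PX PY × Iso (Induced G PX PY) H

data Constructible : BGraph → Set₁ where
  start    : ∀ {G} → Iso SingleEdge G → Constructible G
  doubling : ∀ {G H} → Constructible G → DoublingStep G H → Constructible H
  collapse : ∀ {G H} → Constructible G → CollapseStep G H → Constructible H

data DoublingConstructible : BGraph → Set₁ where
  start    : ∀ {G} → Iso SingleEdge G → DoublingConstructible G
  doubling : ∀ {G H} → DoublingConstructible G → DoublingStep G H → DoublingConstructible H

DoublingsThenLast : BGraph → Set₁
DoublingsThenLast G =
  DoublingConstructible G ⊎ Σ BGraph (λ H → DoublingConstructible H × CollapseStep H G)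

module Submission where

-- Every constructible graph G is a retract of a graph built by doublings alone:
-- a collapse keeps the retract relation, and a doubling of G is a retract of the
-- doubling of the bigger graph with the pulled-back fixed/old marking.  Graphs
-- built by doublings have decidable vertex equality, so the fixed points of the
-- idempotent s ∘ r span an induced subgraph isomorphic to G, onto which s ∘ r is
-- a retraction; this is the single final collapse.

open import Defs
open import Data.Bool using (Bool; true; false; T; not; _∧_)
open import Data.Bool.Properties using (T-∧; T-irrelevant)
open import Data.Empty using (⊥-elim)
open import Data.Product using (Σ; _×_; _,_; proj₁)
import Data.Product.Properties as Σ
open import Data.Sum using (_⊎_; inj₁; inj₂)
import Data.Sum.Properties as ⊎
open import Data.Unit using (tt)
import Data.Unit.Properties as ⊤
open import Function using (_∘_)
open import Function.Bundles using (_↔_; Inverse; mk↔ₛ′; Equivalence)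
open import Function.Construct.Identity using (↔-id)
open import Function.Properties.Inverse using (↔-sym; ↔⇒↣)
open import Relation.Binary.Definitions using (DecidableEquality)
open import Relation.Binary.PropositionalEquality
open import Relation.Nullary.Decidable using (yes; ⌊_⌋; toWitness; fromWitness; via-injection)

T-subtype-≡ : {A : Set} {P : A → Bool} {a b : A} {p : T (P a)} {q : T (P b)} →
              a ≡ b → _≡_ {A = Σ A (T ∘ P)} (a , p) (b , q)
T-subtype-≡ {a = a} refl = cong (a ,_) (T-irrelevant _ _)

T-injective : {a b : Bool} → (T a → T b) → (T b → T a) → a ≡ b
T-injective {true}  {true}  _ _ = refl
T-injective {true}  {false} f _ = ⊥-elim (f tt)
T-injective {false} {true}  _ g = ⊥-elim (g tt)
T-injective {false} {false} _ _ = refl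

Hom-id : (G : BGraph) → Hom G G
Hom-id G = record { homX = λ x → x ; homY = λ y → y ; preserves = λ _ _ e → e }

infixr 9 _∘ʰ_
_∘ʰ_ : {A B C : BGraph} → Hom B C → Hom A B → Hom A C
g ∘ʰ f = record
  { homX = Hom.homX g ∘ Hom.homX f
  ; homY = Hom.homY g ∘ Hom.homY f
  ; preserves = λ x y → Hom.preserves g _ _ ∘ Hom.preserves f x y
  }

Iso-refl : (G : BGraph) → Iso G G
Iso-refl G = record { isoX = ↔-id _ ; isoY = ↔-id _ ; edges = λ _ _ → refl }

record Retract (H G : BGraph) : Set where
  field
    ret : Hom H G
    sec : Hom G H
    ret∘secˣ : ∀ x → Hom.homX ret (Hom.homX sec x) ≡ x
    ret∘secʸ : ∀ y → Hom.homY ret (Hom.homY sec y) ≡ y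

Retract-refl : (G : BGraph) → Retract G G
Retract-refl G = record
  { ret = Hom-id G ; sec = Hom-id G ; ret∘secˣ = λ _ → refl ; ret∘secʸ = λ _ → refl }

Retract-trans : {A B C : BGraph} → Retract A B → Retract B C → Retract A C
Retract-trans R S = record
  { ret = Retract.ret S ∘ʰ Retract.ret R
  ; sec = Retract.sec R ∘ʰ Retract.sec S
  ; ret∘secˣ = λ x → trans (cong (Hom.homX (Retract.ret S)) (Retract.ret∘secˣ R _))
                           (Retract.ret∘secˣ S x)
  ; ret∘secʸ = λ y → trans (cong (Hom.homY (Retract.ret S)) (Retract.ret∘secʸ R _))
                           (Retract.ret∘secʸ S y)
  }

Iso⇒Retract : {G H : BGraph} → Iso G H → Retract G H
Iso⇒Retract {G} {H} I = record
  { ret = record { homX = to isoX ; homY = to isoY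
                 ; preserves = λ x y → subst T (edges x y) }
  ; sec = record { homX = from isoX ; homY = from isoY ; preserves = from-preserves }
  ; ret∘secˣ = strictlyInverseˡ isoX
  ; ret∘secʸ = strictlyInverseˡ isoY
  }
  where
  open Iso I
  open Inverse
  from-preserves : ∀ x y → T (E H x y) → T (E G (from isoX x) (from isoY y))
  from-preserves x y e = subst T (sym (edges _ _))
    (subst₂ (λ a b → T (E H a b))
            (sym (strictlyInverseˡ isoX x)) (sym (strictlyInverseˡ isoY y)) e)

Retraction⇒Retract : {G : BGraph} {PX : X G → Bool} {PY : Y G → Bool} →
                     Retraction G PX PY → Retract G (Induced G PX PY)
Retraction⇒Retract R = record
  { ret = hom
  ; sec = record { homX = proj₁ ; homY = proj₁ ; preserves = λ _ _ e → e }
  ; ret∘secˣ = λ { (x , p) → T-subtype-≡ (idX x p) }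
  ; ret∘secʸ = λ { (y , q) → T-subtype-≡ (idY y q) }
  }
  where open Retraction R

CollapseStep⇒Retract : {G H : BGraph} → CollapseStep G H → Retract G H
CollapseStep⇒Retract (_ , _ , R , I) = Retract-trans (Retraction⇒Retract R) (Iso⇒Retract I)

WithCopies : (A : Set) → (A → Bool) → Set
WithCopies A fixed = A ⊎ Σ A (λ a → T (not (fixed a)))

WithCopies-map : {A B : Set} {fA : A → Bool} {fB : B → Bool} (h : A → B) →
                 (∀ a → fA a ≡ fB (h a)) → WithCopies A fA → WithCopies B fB
WithCopies-map h h-fixed (inj₁ a)       = inj₁ (h a)
WithCopies-map h h-fixed (inj₂ (a , p)) = inj₂ (h a , subst (T ∘ not) (h-fixed a) p)

WithCopies-map-inverse :
  {A B : Set} {fA : A → Bool} {fB : B → Bool} {h : A → B} {g : B → A}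
  (h-fixed : ∀ a → fA a ≡ fB (h a)) (g-fixed : ∀ b → fB b ≡ fA (g b)) →
  (∀ b → h (g b) ≡ b) →
  ∀ v → WithCopies-map h h-fixed (WithCopies-map g g-fixed v) ≡ v
WithCopies-map-inverse _ _ h∘g (inj₁ b)       = cong inj₁ (h∘g b)
WithCopies-map-inverse _ _ h∘g (inj₂ (b , _)) = cong inj₂ (T-subtype-≡ (h∘g b))

WithCopies-≡-dec : {A : Set} {fixed : A → Bool} →
                   DecidableEquality A → DecidableEquality (WithCopies A fixed)
WithCopies-≡-dec _≟_ = ⊎.≡-dec _≟_ (Σ.≡-dec _≟_ λ _ _ → yes (T-irrelevant _ _))

Hom-Double : {A B : BGraph} {fxA : X A → Bool} {fyA : Y A → Bool}
             {fxB : X B → Bool} {fyB : Y B → Bool} (h : Hom A B) →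
             (∀ x → fxA x ≡ fxB (Hom.homX h x)) → (∀ y → fyA y ≡ fyB (Hom.homY h y)) →
             Hom (Double A fxA fyA) (Double B fxB fyB)
Hom-Double {A} {B} {fxA} {fyA} {fxB} {fyB} h h-fx h-fy = record
  { homX = WithCopies-map (homX h) h-fx
  ; homY = WithCopies-map (homY h) h-fy
  ; preserves = preserves′
  }
  where
  open Hom
  open Equivalence
  edge∧ : ∀ {x y} {a b : Bool} → a ≡ b →
          T (E A x y ∧ a) → T (E B (homX h x) (homY h y) ∧ b)
  edge∧ refl e with to T-∧ e
  ... | e′ , m = from T-∧ (preserves h _ _ e′ , m)
  preserves′ : ∀ x y → T (E (Double A fxA fyA) x y) →
               T (E (Double B fxB fyB) (WithCopies-map (homX h) h-fx x)
                                       (WithCopies-map (homY h) h-fy y))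
  preserves′ (inj₁ x)       (inj₁ y)       = preserves h x y
  preserves′ (inj₁ x)       (inj₂ (y , _)) = edge∧ (h-fx x)
  preserves′ (inj₂ (x , _)) (inj₁ y)       = edge∧ (h-fy y)
  preserves′ (inj₂ (x , _)) (inj₂ (y , _)) = preserves h x y

Retract-Double : {H G : BGraph} (R : Retract H G) (fx : X G → Bool) (fy : Y G → Bool) →
                 Retract (Double H (fx ∘ Hom.homX (Retract.ret R)) (fy ∘ Hom.homY (Retract.ret R)))
                         (Double G fx fy)
Retract-Double R fx fy = record
  { ret = Hom-Double ret (λ _ → refl) (λ _ → refl)
  ; sec = Hom-Double sec sec-fx sec-fy
  ; ret∘secˣ = WithCopies-map-inverse (λ _ → refl) sec-fx ret∘secˣ
  ; ret∘secʸ = WithCopies-map-inverse (λ _ → refl) sec-fy ret∘secʸ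
  }
  where
  open Retract R
  sec-fx : ∀ x → fx x ≡ fx (Hom.homX ret (Hom.homX sec x))
  sec-fx x = cong fx (sym (ret∘secˣ x))
  sec-fy : ∀ y → fy y ≡ fy (Hom.homY ret (Hom.homY sec y))
  sec-fy y = cong fy (sym (ret∘secʸ y))

≡-dec-↔ : {A B : Set} → A ↔ B → DecidableEquality A → DecidableEquality B
≡-dec-↔ A↔B = via-injection (↔⇒↣ (↔-sym A↔B))

DoublingConstructible⇒≡-dec : {G : BGraph} → DoublingConstructible G →
                              DecidableEquality (X G) × DecidableEquality (Y G)
DoublingConstructible⇒≡-dec (start I) =
  ≡-dec-↔ (Iso.isoX I) ⊤._≟_ , ≡-dec-↔ (Iso.isoY I) ⊤._≟_
DoublingConstructible⇒≡-dec (doubling D (_ , _ , I)) with DoublingConstructible⇒≡-dec D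
... | _≟ˣ_ , _≟ʸ_ = ≡-dec-↔ (Iso.isoX I) (WithCopies-≡-dec _≟ˣ_)
                  , ≡-dec-↔ (Iso.isoY I) (WithCopies-≡-dec _≟ʸ_)

module FixedPoints {A B : Set} (_≟_ : DecidableEquality A) (r : A → B) (s : B → A)
                   (r∘s : ∀ b → r (s b) ≡ b) where

  fixed : A → Bool
  fixed a = ⌊ s (r a) ≟ a ⌋

  fixed-sec : ∀ b → T (fixed (s b))
  fixed-sec b = fromWitness (cong s (r∘s b))

  project : A → Σ A (T ∘ fixed)
  project a = s (r a) , fixed-sec (r a)

  project-fixed : ∀ a → T (fixed a) → proj₁ (project a) ≡ a
  project-fixed a = toWitness

  fixed↔ : Σ A (T ∘ fixed) ↔ B
  fixed↔ = mk↔ₛ′ (r ∘ proj₁) (λ b → s b , fixed-sec b) r∘s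
                 (λ { (a , p) → T-subtype-≡ (toWitness p) })

Retract⇒CollapseStep : {H G : BGraph} → DecidableEquality (X H) → DecidableEquality (Y H) →
                       Retract H G → CollapseStep H G
Retract⇒CollapseStep {H} {G} _≟ˣ_ _≟ʸ_ R = FX.fixed , FY.fixed , retraction , iso
  where
  open Retract R
  module FX = FixedPoints _≟ˣ_ (Hom.homX ret) (Hom.homX sec) ret∘secˣ
  module FY = FixedPoints _≟ʸ_ (Hom.homY ret) (Hom.homY sec) ret∘secʸ

  retraction : Retraction H FX.fixed FY.fixed
  retraction = record
    { hom = record { homX = FX.project ; homY = FY.project
                   ; preserves = λ x y → Hom.preserves (sec ∘ʰ ret) x y }
    ; idX = FX.project-fixed
    ; idY = FY.project-fixed
    }

  sec-edges : ∀ a b → E H (Hom.homX sec a) (Hom.homY sec b) ≡ E G a b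
  sec-edges a b = T-injective
    (subst₂ (λ u v → T (E G u v)) (ret∘secˣ a) (ret∘secʸ b) ∘ Hom.preserves ret _ _)
    (Hom.preserves sec a b)

  iso : Iso (Induced H FX.fixed FY.fixed) G
  iso = record
    { isoX = FX.fixed↔
    ; isoY = FY.fixed↔
    ; edges = λ { (x , p) (y , q) → begin
        E H x y
          ≡⟨ sym (cong₂ (E H) (toWitness p) (toWitness q)) ⟩
        E H (Hom.homX sec (Hom.homX ret x)) (Hom.homY sec (Hom.homY ret y))
          ≡⟨ sec-edges _ _ ⟩
        E G (Hom.homX ret x) (Hom.homY ret y) ∎ }
    }
    where open ≡-Reasoning

RetractOfDoublingConstructible : BGraph → Set₁
RetractOfDoublingConstructible G = Σ BGraph λ H → DoublingConstructible H × Retract H G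

Constructible⇒RetractOfDoublingConstructible :
  {G : BGraph} → Constructible G → RetractOfDoublingConstructible G
Constructible⇒RetractOfDoublingConstructible (start I) = _ , start I , Retract-refl _
Constructible⇒RetractOfDoublingConstructible (collapse C step)
  with Constructible⇒RetractOfDoublingConstructible C
... | H , D , R = H , D , Retract-trans R (CollapseStep⇒Retract step)
Constructible⇒RetractOfDoublingConstructible (doubling C (fx , fy , I))
  with Constructible⇒RetractOfDoublingConstructible C
... | H , D , R = _ , doubling D (_ , _ , Iso-refl _)
                    , Retract-trans (Retract-Double R fx fy) (Iso⇒Retract I)

lemma8p7 : (G : BGraph) → Constructible G → DoublingsThenLast G
lemma8p7 G C with Constructible⇒RetractOfDoublingConstructible C
... | H , D , R with DoublingConstructible⇒≡-dec D
... | _≟ˣ_ , _≟ʸ_ = inj₂ (H , D , Retract⇒CollapseStep _≟ˣ_ _≟ʸ_ R)
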